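{- Let $d\ge0$, $\mathbb{F}$ a field, $V$ an $\mathbb{F}$-vector space of dimension $d+1$, $T\in{\rm Mat}_{d+1}(\mathbb{F})$ invertible upper triangular, $\{u_i\}_{i=0}^d$ a basis of $V$ and $v_j=\sum_iT_{ij}u_i$. Let $U'_i=\mathbb{F}u_d+\cdots+\mathbb{F}u_{d-i}$ and $U''_i=\mathbb{F}v_d+\cdots+\mathbb{F}v_{d-i}$. Then for $0\le i\le d-1$, $U'_i\cap U''_{d-1-i}=0$ if and only if $\det(T[i+1,d])\neq0$.
   Context: Matrices are indexed by $0,\dots,d$; for $0\le i\le j\le d$, $T[i,j]$ is the submatrix $(T_{kl})_{0\le k\le j-i,\ i\le l\le j}$. -}

module Defs where

open import Level using (Level; _⊔_) renaming (suc to lsuc)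
open import Data.Nat using (ℕ; zero; suc; _∸_)
open import Data.Fin using (Fin; zero; suc; toℕ; punchIn; fromℕ<)
import Data.Fin as Fin
import Data.Nat as Nat
open import Data.Product using (∃; _×_)
open import Relation.Nullary using (¬_; yes; no)
open import Algebra.Bundles using (CommutativeRing)
open import Algebra.Module.Bundles using (Module)

record Field (c ℓ : Level) : Set (lsuc (c ⊔ ℓ)) where
  field
    commutativeRing : CommutativeRing c ℓ
  open CommutativeRing commutativeRing public
  field
    0≉1 : ¬ (0# ≈ 1#)
    inverse : ∀ x → ¬ (x ≈ 0#) → ∃ λ y → (x * y) ≈ 1#

module Setup {c ℓ m ℓm : Level} (F : Field c ℓ)
             (M : Module (Field.commutativeRing F) m ℓm) where
  open Field F using (Carrier; _≈_; _+_; _*_; -_; 0#; 1#)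
  open Module M using (Carrierᴹ; _≈ᴹ_; _+ᴹ_; _*ₗ_; 0ᴹ)

  Mat : ℕ → Set c
  Mat n = Fin n → Fin n → Carrier

  sumF : ∀ n → (Fin n → Carrier) → Carrier
  sumF zero f = 0#
  sumF (suc n) f = f zero + sumF n (λ k → f (suc k))

  sgn : ℕ → Carrier
  sgn zero = 1#
  sgn (suc k) = - sgn k

  det : ∀ n → Mat n → Carrier
  det zero A = 1#
  det (suc n) A =
    sumF (suc n) (λ j → (sgn (toℕ j) * A zero j)
                        * det n (λ r s → A (suc r) (punchIn j s)))

  _·_ : ∀ {n} → Mat n → Mat n → Mat n
  (A · B) i j = sumF _ (λ k → A i k * B k j)

  I : ∀ {n} → Mat n
  I i j with i Fin.≟ j
  ... | yes _ = 1#
  ... | no _ = 0#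

  _≈M_ : ∀ {n} → Mat n → Mat n → Set ℓ
  A ≈M B = ∀ i j → A i j ≈ B i j

  Invertible : ∀ {n} → Mat n → Set (c ⊔ ℓ)
  Invertible {n} A = ∃ λ (B : Mat n) → ((A · B) ≈M I) × ((B · A) ≈M I)

  UpperTriangular : ∀ {n} → Mat n → Set ℓ
  UpperTriangular A = ∀ i j → toℕ j Nat.< toℕ i → A i j ≈ 0#

  -- entry of a (d+1)x(d+1) matrix at natural-number indices (0 outside range;
  -- only ever used inside the range below)
  entry : ∀ {n} → Mat n → ℕ → ℕ → Carrier
  entry {n} A k l with k Nat.<? n | l Nat.<? n
  ... | yes k< | yes l< = A (fromℕ< k<) (fromℕ< l<)
  ... | _ | _ = 0#

  -- T[i,j] = (T_{kl})_{0 ≤ k ≤ j-i, i ≤ l ≤ j}, a (j-i+1)x(j-i+1) matrix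
  sub : ∀ {n} → Mat n → (i j : ℕ) → Mat (suc (j ∸ i))
  sub A i j k l = entry A (toℕ k) (i Nat.+ toℕ l)

  lc : ∀ {n} → (Fin n → Carrier) → (Fin n → Carrierᴹ) → Carrierᴹ
  lc {zero} c w = 0ᴹ
  lc {suc n} c w = (c zero *ₗ w zero) +ᴹ lc (λ k → c (suc k)) (λ k → w (suc k))

  IsBasis : ∀ {n} → (Fin n → Carrierᴹ) → Set (c ⊔ ℓ ⊔ m ⊔ ℓm)
  IsBasis {n} w =
    (∀ x → ∃ λ (a : Fin n → Carrier) → x ≈ᴹ lc a w)
    × (∀ (a : Fin n → Carrier) → lc a w ≈ᴹ 0ᴹ → ∀ k → a k ≈ 0#)

  -- x ∈ F w_{n-1-i} + ... + F w_{n-1}  (span of the last i+1 vectors)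
  InTailSpan : ∀ {n} → (Fin n → Carrierᴹ) → ℕ → Carrierᴹ → Set (c ⊔ ℓ ⊔ ℓm)
  InTailSpan {n} w i x =
    ∃ λ (a : Fin n → Carrier) →
      (∀ k → toℕ k Nat.< (n ∸ 1) ∸ i → a k ≈ 0#) × (x ≈ᴹ lc a w)

  transformed : ∀ {n} → Mat n → (Fin n → Carrierᴹ) → Fin n → Carrierᴹ
  transformed T u j = lc (λ i → T i j) u

  TrivialIntersection : (Carrierᴹ → Set (c ⊔ ℓ ⊔ ℓm)) → (Carrierᴹ → Set (c ⊔ ℓ ⊔ ℓm))
                      → Set (c ⊔ ℓ ⊔ m ⊔ ℓm)
  TrivialIntersection P Q = ∀ x → P x → Q x → x ≈ᴹ 0ᴹ

module Submission where

-- For 0 ≤ i < d the tail spans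
-- U'_i = ⟨u_{d-i}, …, u_d⟩ and U''_{d-1-i} = ⟨v_{i+1}, …, v_d⟩ meet only in 0
-- iff det T[i+1, d] ≠ 0.
--
-- Idea.  A vector Σ_{j>i} b_j v_j has u-coordinates T b, and it lies in U'_i
-- iff the first d-i of these vanish, i.e. iff S (b_j)_{j>i} = 0 for the block
-- S = T[i+1, d].  As T has trivial kernel, U'_i ∩ U''_{d-1-i} = 0 iff S has
-- trivial kernel (module TailBlock), and for a square matrix over a field a
-- trivial kernel is equivalent to a nonzero determinant (trivialKernel⇔det≉0):
-- one direction is Cramer's rule, the other Gaussian elimination on the first row.

open import Defs
open import Level using (_⊔_)
open import Data.Nat as ℕ using (ℕ; zero; suc; _∸_)
import Data.Nat.Properties as ℕP
open import Data.Fin as Fin using (Fin; zero; suc; toℕ; punchIn; punchOut; inject₁; fromℕ<)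
import Data.Fin.Properties as FinP
open import Data.Product using (Σ; ∃; _×_; _,_; proj₁; proj₂)
open import Data.Sum using (_⊎_; inj₁; inj₂; [_,_])
open import Data.Empty using (⊥; ⊥-elim)
open import Relation.Nullary using (¬_; yes; no)
open import Relation.Binary.Definitions using (tri<; tri≈; tri>)
open import Relation.Binary.PropositionalEquality as P using (_≡_; _≢_)
open import Algebra.Module.Bundles using (Module)
open import Function.Bundles using (_⇔_; mk⇔)
open import Function.Properties.Equivalence using () renaming (trans to ⇔-trans)
open import Algebra.Bundles using (CommutativeMonoid)
import Relation.Binary.Reasoning.Setoid
open import Data.Vec.Functional using (updateAt; insertAt)
open import Data.Vec.Functional.Properties using (updateAt-updates; updateAt-minimal; insertAt-lookup; insertAt-punchIn)

module LinearAlgebra {c ℓ m ℓm} (F : Field c ℓ) (M : Module (Field.commutativeRing F) m ℓm) where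
  open Setup F M
  open Field F hiding (zero)
  open import Algebra.Properties.Ring ring using (-‿distribˡ-*; -‿distribʳ-*)
  open import Algebra.Properties.AbelianGroup +-abelianGroup
    using (inverseʳ-unique; x∙y⁻¹≈ε⇒x≈y; ⁻¹-injective; ε⁻¹≈ε; ⁻¹-involutive)
  open import Algebra.Properties.Semiring.Sum semiring
    using (sum; sum-cong-≋; sum-replicate-zero; ∑-distrib-+; ∑-comm; *-distribˡ-sum; sum-remove)
  open import Algebra.Solver.Ring.NaturalCoefficients.Default commutativeSemiring
    using (solve; _:=_; _:+_; _:*_)
  open import Relation.Binary.Reasoning.Setoid setoid

  cancel : ∀ x y → ¬ (x ≈ 0#) → x * y ≈ 0# → y ≈ 0#
  cancel x y x≉0 xy≈0 with inverse x x≉0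
  ... | x⁻¹ , xx⁻¹≈1 = begin
    y                 ≈⟨ *-identityˡ y ⟨
    1# * y            ≈⟨ *-congʳ xx⁻¹≈1 ⟨
    (x * x⁻¹) * y     ≈⟨ solve 3 (λ x y z → (x :* z) :* y := z :* (x :* y)) refl x y x⁻¹ ⟩
    x⁻¹ * (x * y)     ≈⟨ *-congˡ xy≈0 ⟩
    x⁻¹ * 0#          ≈⟨ zeroʳ x⁻¹ ⟩
    0#                ∎

  sgn-sq : ∀ k → sgn k * sgn k ≈ 1#
  sgn-sq zero = *-identityˡ 1#
  sgn-sq (suc k) = begin
    - sgn k * - sgn k     ≈⟨ -‿distribˡ-* (sgn k) (- sgn k) ⟨
    - (sgn k * - sgn k)   ≈⟨ -‿cong (-‿distribʳ-* (sgn k) (sgn k)) ⟨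
    - - (sgn k * sgn k)   ≈⟨ ⁻¹-involutive _ ⟩
    sgn k * sgn k         ≈⟨ sgn-sq k ⟩
    1#                    ∎

  sgn≉0 : ∀ k → ¬ (sgn k ≈ 0#)
  sgn≉0 k sgn≈0 = 0≉1 (begin
    0#              ≈⟨ zeroˡ (sgn k) ⟨
    0# * sgn k      ≈⟨ *-congʳ sgn≈0 ⟨
    sgn k * sgn k   ≈⟨ sgn-sq k ⟩
    1#              ∎)

  -- Classically a vector is zero or has a nonzero entry; constructively this
  -- holds up to double negation, which suffices when proving a negation.
  zero-or-nonzero : ∀ n (f : Fin n → Carrier) →
    ¬ ¬ ((∀ j → f j ≈ 0#) ⊎ (∃ λ p → ¬ (f p ≈ 0#)))
  zero-or-nonzero zero f neither = neither (inj₁ (λ ()))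
  zero-or-nonzero (suc n) f neither = zero-or-nonzero n (λ j → f (suc j)) [ tailZero , tailNonzero ]
    where
    tailZero : (∀ j → f (suc j) ≈ 0#) → ⊥
    tailZero f'≈0 = neither (inj₂ (zero , λ f0≈0 → neither (inj₁ λ { zero → f0≈0 ; (suc j) → f'≈0 j })))
    tailNonzero : (∃ λ p → ¬ (f (suc p) ≈ 0#)) → ⊥
    tailNonzero (p , fp≉0) = neither (inj₂ (suc p , fp≉0))

  x+0y≈x : ∀ x y → x + 0# * y ≈ x
  x+0y≈x x y = trans (+-congˡ (zeroˡ y)) (+-identityʳ x)

  cleared : ∀ a c β → c * β ≈ 1# → a + (- (a * β)) * c ≈ 0#
  cleared a c β cβ≈1 = begin
    a + (- (a * β)) * c   ≈⟨ +-congˡ (-‿distribˡ-* _ _) ⟨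
    a + - ((a * β) * c)   ≈⟨ +-congˡ (-‿cong (solve 3 (λ a β c → (a :* β) :* c := a :* (c :* β)) refl a β c)) ⟩
    a + - (a * (c * β))   ≈⟨ +-congˡ (-‿cong (trans (*-congˡ cβ≈1) (*-identityʳ a))) ⟩
    a + - a               ≈⟨ -‿inverseʳ a ⟩
    0#                    ∎

  -- sumF is the library's sum over Fin n, so its algebra is inherited from the library.
  sumF≈sum : ∀ n (f : Fin n → Carrier) → sumF n f ≈ sum f
  sumF≈sum zero f = refl
  sumF≈sum (suc n) f = +-congˡ (sumF≈sum n (λ k → f (suc k)))

  sumF-cong : ∀ n {f g : Fin n → Carrier} → (∀ k → f k ≈ g k) → sumF n f ≈ sumF n g
  sumF-cong n {f} {g} f≈g = begin
    sumF n f   ≈⟨ sumF≈sum n f ⟩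
    sum f      ≈⟨ sum-cong-≋ f≈g ⟩
    sum g      ≈⟨ sumF≈sum n g ⟨
    sumF n g   ∎

  sumF-zero : ∀ n {f : Fin n → Carrier} → (∀ k → f k ≈ 0#) → sumF n f ≈ 0#
  sumF-zero n {f} f≈0 = trans (sumF-cong n f≈0) (trans (sumF≈sum n _) (sum-replicate-zero n))

  sumF-+ : ∀ n (f g : Fin n → Carrier) → sumF n (λ k → f k + g k) ≈ sumF n f + sumF n g
  sumF-+ n f g = begin
    sumF n (λ k → f k + g k)  ≈⟨ sumF≈sum n _ ⟩
    sum (λ k → f k + g k)     ≈⟨ ∑-distrib-+ f g ⟩
    sum f + sum g             ≈⟨ +-cong (sumF≈sum n f) (sumF≈sum n g) ⟨
    sumF n f + sumF n g       ∎

  sumF-* : ∀ n x (f : Fin n → Carrier) → sumF n (λ k → x * f k) ≈ x * sumF n f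
  sumF-* n x f = begin
    sumF n (λ k → x * f k)  ≈⟨ sumF≈sum n _ ⟩
    sum (λ k → x * f k)     ≈⟨ *-distribˡ-sum x f ⟨
    x * sum f               ≈⟨ *-congˡ (sumF≈sum n f) ⟨
    x * sumF n f            ∎

  sumF-swap : ∀ n k (f : Fin n → Fin k → Carrier) →
    sumF n (λ i → sumF k (λ j → f i j)) ≈ sumF k (λ j → sumF n (λ i → f i j))
  sumF-swap n k f = begin
    sumF n (λ i → sumF k (f i))               ≈⟨ sumF-cong n (λ i → sumF≈sum k (f i)) ⟩
    sumF n (λ i → sum (f i))                  ≈⟨ sumF≈sum n _ ⟩
    sum (λ i → sum (f i))                     ≈⟨ ∑-comm f ⟩
    sum (λ j → sum (λ i → f i j))             ≈⟨ sumF≈sum k _ ⟨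
    sumF k (λ j → sum (λ i → f i j))          ≈⟨ sumF-cong k (λ j → sumF≈sum n (λ i → f i j)) ⟨
    sumF k (λ j → sumF n (λ i → f i j))       ∎

  sumF-punch : ∀ n (f : Fin (suc n) → Carrier) (p : Fin (suc n)) →
    sumF (suc n) f ≈ f p + sumF n (λ j → f (punchIn p j))
  sumF-punch n f p = begin
    sumF (suc n) f                       ≈⟨ sumF≈sum (suc n) f ⟩
    sum f                                ≈⟨ sum-remove f ⟩
    f p + sum (λ j → f (punchIn p j))    ≈⟨ +-congˡ (sumF≈sum n _) ⟨
    f p + sumF n (λ j → f (punchIn p j)) ∎

  sumF-single : ∀ n (f : Fin n → Carrier) (k : Fin n) → (∀ j → j ≢ k → f j ≈ 0#) → sumF n f ≈ f k
  sumF-single (suc n) f k off = begin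
    sumF (suc n) f                       ≈⟨ sumF-punch n f k ⟩
    f k + sumF n (λ j → f (punchIn k j)) ≈⟨ +-congˡ (sumF-zero n (λ j → off _ (FinP.punchInᵢ≢i k j))) ⟩
    f k + 0#                             ≈⟨ +-identityʳ _ ⟩
    f k                                  ∎

  sumF-two : ∀ n (f : Fin (suc n) → Carrier) (p k : Fin (suc n)) → p ≢ k →
    (∀ j → j ≢ p → j ≢ k → f j ≈ 0#) → sumF (suc n) f ≈ f p + f k
  sumF-two n f p k p≢k off = begin
    sumF (suc n) f                        ≈⟨ sumF-punch n f p ⟩
    f p + sumF n (λ j → f (punchIn p j))  ≈⟨ +-congˡ (sumF-single n _ k′ off′) ⟩
    f p + f (punchIn p k′)                ≡⟨ P.cong (λ z → f p + f z) (FinP.punchIn-punchOut p≢k) ⟩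
    f p + f k                             ∎
    where
    k′ = punchOut p≢k
    off′ : ∀ j → j ≢ k′ → f (punchIn p j) ≈ 0#
    off′ j j≢k′ = off _ (FinP.punchInᵢ≢i p j)
      (λ e → j≢k′ (FinP.punchIn-injective p j k′ (P.trans e (P.sym (FinP.punchIn-punchOut p≢k)))))

  -- Coefficient vectors vanishing below index k; InTailSpan w i is the set of
  -- combinations of w with such coefficients for k = (n ∸ 1) ∸ i.
  VanishBelow : ∀ {n} → ℕ → (Fin n → Carrier) → Set ℓ
  VanishBelow k a = ∀ j → toℕ j ℕ.< k → a j ≈ 0#

  VanishBelow-cong : ∀ {n k k′} {a : Fin n → Carrier} → k ≡ k′ → VanishBelow k a → VanishBelow k′ a
  VanishBelow-cong P.refl a≈0 = a≈0

  sumF-tail : ∀ s N len (f : Fin N → Carrier) (ψ : Fin len → Fin N) → (∀ l → toℕ (ψ l) ≡ s ℕ.+ toℕ l) →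
    s ℕ.+ len ≡ N → VanishBelow s f → sumF N f ≈ sumF len (λ l → f (ψ l))
  sumF-tail zero N .N f ψ ψ-toℕ P.refl f≈0 =
    sumF-cong N (λ l → reflexive (P.cong f (P.sym (FinP.toℕ-injective (ψ-toℕ l)))))
  sumF-tail (suc s) .(suc (s ℕ.+ len)) len f ψ ψ-toℕ P.refl f≈0 = begin
    f zero + sumF (s ℕ.+ len) (λ k → f (suc k))  ≈⟨ +-cong (f≈0 zero (ℕ.s≤s ℕ.z≤n)) shifted ⟩
    0# + sumF len (λ l → f (suc (ψ′ l)))          ≈⟨ +-identityˡ _ ⟩
    sumF len (λ l → f (suc (ψ′ l)))               ≈⟨ sumF-cong len (λ l → reflexive (P.cong f (suc-ψ′ l))) ⟩
    sumF len (λ l → f (ψ l))                      ∎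
    where
    predecessor : ∀ l → Σ (Fin (s ℕ.+ len)) λ k → suc k ≡ ψ l
    predecessor l with ψ l | ψ-toℕ l
    ... | suc k | _ = k , P.refl
    ψ′ : Fin len → Fin (s ℕ.+ len)
    ψ′ l = proj₁ (predecessor l)
    suc-ψ′ : ∀ l → suc (ψ′ l) ≡ ψ l
    suc-ψ′ l = proj₂ (predecessor l)
    shifted : sumF (s ℕ.+ len) (λ k → f (suc k)) ≈ sumF len (λ l → f (suc (ψ′ l)))
    shifted = sumF-tail s (s ℕ.+ len) len (λ k → f (suc k)) ψ′
      (λ l → ℕP.suc-injective (P.trans (P.cong toℕ (suc-ψ′ l)) (ψ-toℕ l))) P.refl
      (λ j j<s → f≈0 (suc j) (ℕ.s≤s j<s))

  setCol : ∀ {n} → Mat n → Fin n → (Fin n → Carrier) → Mat n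
  setCol A k v r = updateAt (A r) k (λ _ → v r)

  setCol-at : ∀ {n} (A : Mat n) k v r → setCol A k v r k ≡ v r
  setCol-at A k v r = updateAt-updates k (A r)

  setCol-off : ∀ {n} (A : Mat n) k v r j → j ≢ k → setCol A k v r j ≡ A r j
  setCol-off A k v r j j≢k = updateAt-minimal j k (A r) j≢k

  minor : ∀ {n} → Mat (suc n) → Fin (suc n) → Mat n
  minor A j r s = A (suc r) (punchIn j s)

  term : ∀ {n} → Mat (suc n) → Fin (suc n) → Carrier
  term {n} A j = (sgn (toℕ j) * A zero j) * det n (minor A j)

  det-cong : ∀ n {A B : Mat n} → (∀ r s → A r s ≈ B r s) → det n A ≈ det n B
  det-cong zero A≈B = refl
  det-cong (suc n) {A} {B} A≈B = sumF-cong (suc n) {term A} {term B} λ j →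
    *-cong (*-congˡ (A≈B zero j)) (det-cong n (λ r s → A≈B (suc r) (punchIn j s)))

  det-lin : ∀ n (k : Fin n) (x y : Carrier) (A B C : Mat n) →
    (∀ r j → j ≢ k → A r j ≈ C r j) → (∀ r j → j ≢ k → B r j ≈ C r j) →
    (∀ r → C r k ≈ x * A r k + y * B r k) → det n C ≈ x * det n A + y * det n B
  det-lin (suc n) k x y A B C A≈C B≈C Cₖ = begin
    sumF (suc n) (term C)                                           ≈⟨ sumF-cong (suc n) termwise ⟩
    sumF (suc n) (λ j → x * term A j + y * term B j)                ≈⟨ sumF-+ (suc n) (λ j → x * term A j) (λ j → y * term B j) ⟩
    sumF (suc n) (λ j → x * term A j) + sumF (suc n) (λ j → y * term B j)
                                              ≈⟨ +-cong (sumF-* (suc n) x (term A)) (sumF-* (suc n) y (term B)) ⟩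
    x * sumF (suc n) (term A) + y * sumF (suc n) (term B)           ∎
    where
    termwise : ∀ j → term C j ≈ x * term A j + y * term B j
    termwise j with j Fin.≟ k
    -- j = k: the minors of A, B, C at k coincide and the entries combine linearly.
    ... | yes P.refl = begin
      (sgn (toℕ j) * C zero j) * det n (minor C j)
        ≈⟨ *-cong (*-congˡ (Cₖ zero)) (det-cong n (λ r s → sym (A≈C (suc r) (punchIn j s) (FinP.punchInᵢ≢i j s)))) ⟩
      (sgn (toℕ j) * (x * A zero j + y * B zero j)) * det n (minor A j)
        ≈⟨ solve 6 (λ s x y a b d → (s :* (x :* a :+ y :* b)) :* d
                                      := x :* ((s :* a) :* d) :+ y :* ((s :* b) :* d)) refl _ _ _ _ _ _ ⟩
      x * term A j + y * ((sgn (toℕ j) * B zero j) * det n (minor A j))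
        ≈⟨ +-congˡ (*-congˡ (*-congˡ (det-cong n (λ r s →
             trans (A≈C (suc r) (punchIn j s) (FinP.punchInᵢ≢i j s))
                   (sym (B≈C (suc r) (punchIn j s) (FinP.punchInᵢ≢i j s))))))) ⟩
      x * term A j + y * term B j ∎
    -- j ≠ k: the first-row entries agree and the minors satisfy the same
    -- hypotheses in column punchOut k, so induction applies.
    ... | no j≢k = begin
      (sgn (toℕ j) * C zero j) * det n (minor C j)
        ≈⟨ *-congˡ minorLinear ⟩
      (sgn (toℕ j) * C zero j) * (x * det n (minor A j) + y * det n (minor B j))
        ≈⟨ solve 6 (λ s c x y da db → (s :* c) :* (x :* da :+ y :* db)
                                      := x :* ((s :* c) :* da) :+ y :* ((s :* c) :* db)) refl _ _ _ _ _ _ ⟩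
      x * ((sgn (toℕ j) * C zero j) * det n (minor A j)) + y * ((sgn (toℕ j) * C zero j) * det n (minor B j))
        ≈⟨ +-cong (*-congˡ (*-congʳ (*-congˡ (sym (A≈C zero j j≢k)))))
                  (*-congˡ (*-congʳ (*-congˡ (sym (B≈C zero j j≢k))))) ⟩
      x * term A j + y * term B j ∎
      where
      k′ : Fin n
      k′ = punchOut j≢k
      punchIn-k′ : punchIn j k′ ≡ k
      punchIn-k′ = FinP.punchIn-punchOut j≢k
      off : ∀ s → s ≢ k′ → punchIn j s ≢ k
      off s s≢k′ e = s≢k′ (FinP.punchIn-injective j s k′ (P.trans e (P.sym punchIn-k′)))
      minorLinear : det n (minor C j) ≈ x * det n (minor A j) + y * det n (minor B j)
      minorLinear = det-lin n k′ x y (minor A j) (minor B j) (minor C j)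
        (λ r s s≢k′ → A≈C (suc r) (punchIn j s) (off s s≢k′))
        (λ r s s≢k′ → B≈C (suc r) (punchIn j s) (off s s≢k′))
        (λ r → P.subst (λ z → C (suc r) z ≈ x * A (suc r) z + y * B (suc r) z) (P.sym punchIn-k′) (Cₖ (suc r)))

  det-zeroCol : ∀ n (A : Mat n) k → (∀ r → A r k ≈ 0#) → det n A ≈ 0#
  det-zeroCol n A k Aₖ≈0 =
    trans (det-lin n k 0# 0# A A A (λ _ _ _ → refl) (λ _ _ _ → refl) (λ r → trans (Aₖ≈0 r) (sym 0a+0b≈0)))
          0a+0b≈0
    where
    0a+0b≈0 : ∀ {a b} → 0# * a + 0# * b ≈ 0#
    0a+0b≈0 = trans (+-cong (zeroˡ _) (zeroˡ _)) (+-identityˡ 0#)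

  det-setCol-+ : ∀ n (A : Mat n) k (a b : Fin n → Carrier) →
    det n (setCol A k (λ r → a r + b r)) ≈ det n (setCol A k a) + det n (setCol A k b)
  det-setCol-+ n A k a b = trans
    (det-lin n k 1# 1# (setCol A k a) (setCol A k b) (setCol A k (λ r → a r + b r)) sameOff sameOff new)
    (+-cong (*-identityˡ _) (*-identityˡ _))
    where
    sameOff : ∀ {v w : Fin n → Carrier} r j → j ≢ k → setCol A k v r j ≈ setCol A k w r j
    sameOff {v} {w} r j j≢k = reflexive (P.trans (setCol-off A k v r j j≢k) (P.sym (setCol-off A k w r j j≢k)))
    new : ∀ r → setCol A k (λ r → a r + b r) r k ≈ 1# * setCol A k a r k + 1# * setCol A k b r k
    new r = begin
      setCol A k (λ r → a r + b r) r k   ≡⟨ setCol-at A k (λ r → a r + b r) r ⟩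
      a r + b r                          ≈⟨ +-cong (*-identityˡ (a r)) (*-identityˡ (b r)) ⟨
      1# * a r + 1# * b r                ≡⟨ P.cong₂ (λ s t → 1# * s + 1# * t) (setCol-at A k a r) (setCol-at A k b r) ⟨
      1# * setCol A k a r k + 1# * setCol A k b r k ∎

  det-setCol-* : ∀ n (A : Mat n) k x (v : Fin n → Carrier) →
    det n (setCol A k (λ r → x * v r)) ≈ x * det n (setCol A k v)
  det-setCol-* n A k x v = trans
    (det-lin n k x 0# (setCol A k v) (setCol A k v) (setCol A k (λ r → x * v r)) sameOff sameOff new)
    (trans (+-congˡ (zeroˡ _)) (+-identityʳ _))
    where
    sameOff : ∀ r j → j ≢ k → setCol A k v r j ≈ setCol A k (λ r → x * v r) r j
    sameOff r j j≢k = reflexive (P.trans (setCol-off A k v r j j≢k) (P.sym (setCol-off A k (λ r → x * v r) r j j≢k)))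
    new : ∀ r → setCol A k (λ r → x * v r) r k ≈ x * setCol A k v r k + 0# * setCol A k v r k
    new r = begin
      setCol A k (λ r → x * v r) r k          ≡⟨ setCol-at A k (λ r → x * v r) r ⟩
      x * v r                                 ≡⟨ P.cong (x *_) (setCol-at A k v r) ⟨
      x * setCol A k v r k                    ≈⟨ x+0y≈x _ _ ⟨
      x * setCol A k v r k + 0# * setCol A k v r k ∎

  det-setCol-sum : ∀ n (A : Mat n) k mm (b : Fin mm → Carrier) (cs : Fin mm → Fin n → Carrier) →
    det n (setCol A k (λ r → sumF mm (λ l → b l * cs l r))) ≈ sumF mm (λ l → b l * det n (setCol A k (cs l)))
  det-setCol-sum n A k zero b cs = det-zeroCol n _ k (λ r → reflexive (setCol-at A k (λ _ → 0#) r))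
  det-setCol-sum n A k (suc mm) b cs = begin
    det n (setCol A k (λ r → b zero * cs zero r + rest r))
                                  ≈⟨ det-setCol-+ n A k (λ r → b zero * cs zero r) rest ⟩
    det n (setCol A k (λ r → b zero * cs zero r)) + det n (setCol A k rest)
                                  ≈⟨ +-cong (det-setCol-* n A k (b zero) (cs zero))
                                            (det-setCol-sum n A k mm (λ l → b (suc l)) (λ l → cs (suc l))) ⟩
    sumF (suc mm) (λ l → b l * det n (setCol A k (cs l))) ∎
    where
    rest : Fin n → Carrier
    rest r = sumF mm (λ l → b (suc l) * cs (suc l) r)

  inject₁≢suc : ∀ {n} (q : Fin n) → inject₁ q ≢ suc q
  inject₁≢suc q e = ℕP.1+n≢n (P.sym (P.trans (P.sym (FinP.toℕ-inject₁ q)) (P.cong toℕ e)))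

  -- Deleting one of two adjacent columns leaves the same columns, except that
  -- at one position the two deleted-column choices see each other's column.
  punchIn-adjacent : ∀ {n} (q s : Fin (suc n)) →
    (punchIn (inject₁ q) s ≡ punchIn (suc q) s)
    ⊎ ((punchIn (inject₁ q) s ≡ suc q) × (punchIn (suc q) s ≡ inject₁ q))
  punchIn-adjacent zero zero = inj₂ (P.refl , P.refl)
  punchIn-adjacent zero (suc s) = inj₁ P.refl
  punchIn-adjacent {suc n} (suc q) zero = inj₁ P.refl
  punchIn-adjacent {suc n} (suc q) (suc s) with punchIn-adjacent q s
  ... | inj₁ e = inj₁ (P.cong suc e)
  ... | inj₂ (e₁ , e₂) = inj₂ (P.cong suc e₁ , P.cong suc e₂)

  adjacent-in-minor : ∀ {n} (j : Fin (suc (suc n))) (q : Fin (suc n)) → j ≢ inject₁ q → j ≢ suc q →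
    Σ (Fin n) λ q′ → (punchIn j (inject₁ q′) ≡ inject₁ q) × (punchIn j (suc q′) ≡ suc q)
  adjacent-in-minor zero zero j≢q _ = ⊥-elim (j≢q P.refl)
  adjacent-in-minor zero (suc q) _ _ = q , P.refl , P.refl
  adjacent-in-minor (suc zero) zero _ j≢q+1 = ⊥-elim (j≢q+1 P.refl)
  adjacent-in-minor {suc n} (suc (suc j)) zero _ _ = zero , P.refl , P.refl
  adjacent-in-minor {suc n} (suc j) (suc q) j≢q j≢q+1
    with adjacent-in-minor j q (λ e → j≢q (P.cong suc e)) (λ e → j≢q+1 (P.cong suc e))
  ... | q′ , e₁ , e₂ = suc q′ , P.cong suc e₁ , P.cong suc e₂

  -- Two equal adjacent columns force det = 0: the Laplace terms at the two
  -- columns cancel, and every other term has a minor with two equal adjacent columns.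
  mutual
    det-adjacent : ∀ n (A : Mat (suc (suc n))) (q : Fin (suc n)) →
      (∀ r → A r (inject₁ q) ≈ A r (suc q)) → det (suc (suc n)) A ≈ 0#
    det-adjacent n A q equal = begin
      sumF (suc (suc n)) (term A)                  ≈⟨ sumF-two (suc n) (term A) (inject₁ q) (suc q) (inject₁≢suc q)
                                                                (term-off n A q equal) ⟩
      term A (inject₁ q) + term A (suc q)          ≈⟨ +-congʳ (*-congʳ (*-congʳ (reflexive (P.cong sgn (FinP.toℕ-inject₁ q))))) ⟩
      (s * a) * D + (- s * A zero (suc q)) * det (suc n) (minor A (suc q))
                                                   ≈⟨ +-congˡ (*-cong (*-congˡ (sym (equal zero))) (det-cong (suc n) sameMinor)) ⟩
      (s * a) * D + (- s * a) * D                  ≈⟨ +-congˡ (*-congʳ (-‿distribˡ-* s a)) ⟨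
      (s * a) * D + (- (s * a)) * D                ≈⟨ +-congˡ (-‿distribˡ-* (s * a) D) ⟨
      (s * a) * D + - ((s * a) * D)                ≈⟨ -‿inverseʳ _ ⟩
      0#                                           ∎
      where
      s a D : Carrier
      s = sgn (toℕ q)
      a = A zero (inject₁ q)
      D = det (suc n) (minor A (inject₁ q))
      sameMinor : ∀ r t → minor A (suc q) r t ≈ minor A (inject₁ q) r t
      sameMinor r t with punchIn-adjacent q t
      ... | inj₁ e = reflexive (P.cong (A (suc r)) (P.sym e))
      ... | inj₂ (e₁ , e₂) = begin
        A (suc r) (punchIn (suc q) t)     ≡⟨ P.cong (A (suc r)) e₂ ⟩
        A (suc r) (inject₁ q)             ≈⟨ equal (suc r) ⟩
        A (suc r) (suc q)                 ≡⟨ P.cong (A (suc r)) e₁ ⟨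
        A (suc r) (punchIn (inject₁ q) t) ∎

    term-off : ∀ n (A : Mat (suc (suc n))) (q : Fin (suc n)) → (∀ r → A r (inject₁ q) ≈ A r (suc q)) →
      ∀ j → j ≢ inject₁ q → j ≢ suc q → term A j ≈ 0#
    term-off n A q equal j j≢q j≢q+1 with adjacent-in-minor j q j≢q j≢q+1
    term-off zero A q equal j j≢q j≢q+1 | () , _
    term-off (suc n) A q equal j j≢q j≢q+1 | q′ , e₁ , e₂ = trans (*-congˡ minor≈0) (zeroʳ _)
      where
      minor≈0 : det (suc (suc n)) (minor A j) ≈ 0#
      minor≈0 = det-adjacent n (minor A j) q′
        (λ r → P.subst₂ (λ x y → A (suc r) x ≈ A (suc r) y) (P.sym e₁) (P.sym e₂) (equal (suc r)))

  setCol-comm : ∀ {n} (A : Mat n) (p k : Fin n) u v → p ≢ k →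
    ∀ r j → setCol (setCol A p u) k v r j ≡ setCol (setCol A k v) p u r j
  setCol-comm A p k u v p≢k r j with j Fin.≟ p | j Fin.≟ k
  ... | yes P.refl | yes P.refl = ⊥-elim (p≢k P.refl)
  ... | yes P.refl | no j≢k = P.trans (setCol-off (setCol A j u) k v r j j≢k)
                                (P.trans (setCol-at A j u r) (P.sym (setCol-at (setCol A k v) j u r)))
  ... | no j≢p | yes P.refl = P.trans (setCol-at (setCol A p u) j v r)
                                (P.trans (P.sym (setCol-at A j v r)) (P.sym (setCol-off (setCol A j v) p u r j j≢p)))
  ... | no j≢p | no j≢k = P.trans (setCol-off (setCol A p u) k v r j j≢k)
                            (P.trans (setCol-off A p u r j j≢p)
                              (P.sym (P.trans (setCol-off (setCol A k v) p u r j j≢p) (setCol-off A k v r j j≢k))))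

  swapCols : ∀ {n} → Mat n → Fin n → Fin n → Mat n
  swapCols A p k = setCol (setCol A p (λ r → A r k)) k (λ r → A r p)

  -- If det vanishes whenever columns p and k agree, then exchanging columns p
  -- and k changes its sign: expand D(X+Y, X+Y) = 0 bilinearly, where D(u, v)
  -- is det with columns p, k replaced by u, v.
  det-swap : ∀ n (p k : Fin n) → p ≢ k → (∀ B → (∀ r → B r p ≈ B r k) → det n B ≈ 0#) →
    ∀ A → det n (swapCols A p k) ≈ - det n A
  det-swap n p k p≢k alternating A = begin
    D Y X         ≈⟨ inverseʳ-unique (D X Y) (D Y X) cancelling ⟩
    - D X Y       ≈⟨ -‿cong (det-cong n D[X,Y]≈A) ⟩
    - det n A     ∎
    where
    X Y : Fin n → Carrier
    X r = A r p
    Y r = A r k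
    D : (Fin n → Carrier) → (Fin n → Carrier) → Carrier
    D u v = det n (setCol (setCol A p u) k v)
    D-diag : ∀ u → D u u ≈ 0#
    D-diag u = alternating _ (λ r → reflexive (P.trans (setCol-off (setCol A p u) k u r p p≢k)
                                        (P.trans (setCol-at A p u r) (P.sym (setCol-at (setCol A p u) k u r)))))
    D-+ˡ : ∀ u u′ v → D (λ r → u r + u′ r) v ≈ D u v + D u′ v
    D-+ˡ u u′ v = begin
      D (λ r → u r + u′ r) v                        ≈⟨ det-cong n (λ r j → reflexive (setCol-comm A p k (λ r → u r + u′ r) v p≢k r j)) ⟩
      det n (setCol (setCol A k v) p (λ r → u r + u′ r)) ≈⟨ det-setCol-+ n (setCol A k v) p u u′ ⟩
      det n (setCol (setCol A k v) p u) + det n (setCol (setCol A k v) p u′)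
        ≈⟨ +-cong (det-cong n (λ r j → reflexive (setCol-comm A p k u v p≢k r j)))
                  (det-cong n (λ r j → reflexive (setCol-comm A p k u′ v p≢k r j))) ⟨
      D u v + D u′ v                                ∎
    D-+ʳ : ∀ u v v′ → D u (λ r → v r + v′ r) ≈ D u v + D u v′
    D-+ʳ u = det-setCol-+ n (setCol A p u) k
    cancelling : D X Y + D Y X ≈ 0#
    cancelling = begin
      D X Y + D Y X                          ≈⟨ +-cong (+-identityˡ _) (+-identityʳ _) ⟨
      (0# + D X Y) + (D Y X + 0#)            ≈⟨ +-cong (+-congʳ (D-diag X)) (+-congˡ (D-diag Y)) ⟨
      (D X X + D X Y) + (D Y X + D Y Y)      ≈⟨ +-cong (D-+ʳ X X Y) (D-+ʳ Y X Y) ⟨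
      D X (λ r → X r + Y r) + D Y (λ r → X r + Y r) ≈⟨ D-+ˡ X Y _ ⟨
      D (λ r → X r + Y r) (λ r → X r + Y r)  ≈⟨ D-diag _ ⟩
      0#                                     ∎
    D[X,Y]≈A : ∀ r j → setCol (setCol A p X) k Y r j ≈ A r j
    D[X,Y]≈A r j with j Fin.≟ k | j Fin.≟ p
    ... | yes P.refl | _ = reflexive (setCol-at (setCol A p X) j Y r)
    ... | no j≢k | yes P.refl = reflexive (P.trans (setCol-off (setCol A j X) k Y r j j≢k) (setCol-at A j X r))
    ... | no j≢k | no j≢p = reflexive (P.trans (setCol-off (setCol A p X) k Y r j j≢k) (setCol-off A p X r j j≢p))

  -- Two equal columns at distance dd + 1 force det = 0: swap the right one
  -- leftwards with its neighbour until the two columns are adjacent.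
  det-equalCols-at : ∀ dd {n} (A : Mat n) (p k : Fin n) → toℕ k ≡ suc (dd ℕ.+ toℕ p) →
    (∀ r → A r p ≈ A r k) → det n A ≈ 0#
  det-equalCols-at dd {suc zero} A p (suc ()) e equal
  det-equalCols-at zero {suc (suc n)} A p (suc q) e equal =
    det-adjacent n A q (λ r → P.subst (λ x → A r x ≈ A r (suc q)) p≡q (equal r))
    where
    p≡q : p ≡ inject₁ q
    p≡q = FinP.toℕ-injective (P.trans (P.sym (ℕP.suc-injective e)) (P.sym (FinP.toℕ-inject₁ q)))
  det-equalCols-at (suc dd) {suc (suc n)} A p (suc q) e equal =
    ⁻¹-injective (trans (sym swapped) (trans swapped≈0 (sym ε⁻¹≈ε)))
    where
    Aq Aq+1 : Fin (suc (suc n)) → Carrier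
    Aq r = A r (inject₁ q)
    Aq+1 r = A r (suc q)
    B′ B : Mat (suc (suc n))
    B′ = setCol A (inject₁ q) Aq+1
    B = setCol B′ (suc q) Aq
    swapped : det (suc (suc n)) B ≈ - det (suc (suc n)) A
    swapped = det-swap _ (inject₁ q) (suc q) (inject₁≢suc q) (λ B → det-adjacent n B q) A
    toℕq : toℕ (inject₁ q) ≡ suc (dd ℕ.+ toℕ p)
    toℕq = P.trans (FinP.toℕ-inject₁ q) (ℕP.suc-injective e)
    p≢q : p ≢ inject₁ q
    p≢q p≡q = ℕP.m≢1+n+m (toℕ p) (P.trans (P.cong toℕ p≡q) toℕq)
    p≢q+1 : p ≢ suc q
    p≢q+1 p≡q+1 = ℕP.m≢1+n+m (toℕ p) {suc dd} (P.trans (P.cong toℕ p≡q+1) e)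
    B-equal : ∀ r → B r p ≈ B r (inject₁ q)
    B-equal r = begin
      B r p               ≡⟨ P.trans (setCol-off B′ (suc q) Aq r p p≢q+1) (setCol-off A (inject₁ q) Aq+1 r p p≢q) ⟩
      A r p               ≈⟨ equal r ⟩
      A r (suc q)         ≡⟨ P.trans (setCol-off B′ (suc q) Aq r (inject₁ q) (inject₁≢suc q)) (setCol-at A (inject₁ q) Aq+1 r) ⟨
      B r (inject₁ q)     ∎
    swapped≈0 : det (suc (suc n)) B ≈ 0#
    swapped≈0 = det-equalCols-at dd B p (inject₁ q) toℕq B-equal

  distance : ∀ {a b} → a ℕ.< b → b ≡ suc ((b ∸ suc a) ℕ.+ a)
  distance {a} {b} a<b = P.trans (P.sym (ℕP.m∸n+n≡m a<b)) (ℕP.+-suc (b ∸ suc a) a)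

  det-equalCols : ∀ n (A : Mat n) (p k : Fin n) → p ≢ k → (∀ r → A r p ≈ A r k) → det n A ≈ 0#
  det-equalCols n A p k p≢k equal with ℕP.<-cmp (toℕ p) (toℕ k)
  ... | tri< p<k _ _ = det-equalCols-at _ A p k (distance p<k) equal
  ... | tri≈ _ p≡k _ = ⊥-elim (p≢k (FinP.toℕ-injective p≡k))
  ... | tri> _ _ k<p = det-equalCols-at _ A k p (distance k<p) (λ r → sym (equal r))

  -- Adding γ times column p to another column k leaves det unchanged, by
  -- linearity in column k and the vanishing for two equal columns.
  det-addCol : ∀ n (A B : Mat n) (p k : Fin n) (γ : Carrier) → k ≢ p →
    (∀ r j → j ≢ k → A r j ≈ B r j) → (∀ r → B r k ≈ A r k + γ * A r p) → det n B ≈ det n A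
  det-addCol n A B p k γ k≢p same added = begin
    det n B                     ≈⟨ det-lin n k 1# γ A A′ B same A′≈B B≈A+γA′ ⟩
    1# * det n A + γ * det n A′ ≈⟨ +-cong (*-identityˡ _) (*-congˡ (det-equalCols n A′ k p k≢p A′-equal)) ⟩
    det n A + γ * 0#            ≈⟨ +-congˡ (zeroʳ γ) ⟩
    det n A + 0#                ≈⟨ +-identityʳ _ ⟩
    det n A                     ∎
    where
    colₚ : Fin n → Carrier
    colₚ r = A r p
    A′ : Mat n
    A′ = setCol A k colₚ
    A′≈B : ∀ r j → j ≢ k → A′ r j ≈ B r j
    A′≈B r j j≢k = trans (reflexive (setCol-off A k colₚ r j j≢k)) (same r j j≢k)
    A′-equal : ∀ r → A′ r k ≈ A′ r p
    A′-equal r = reflexive (P.trans (setCol-at A k colₚ r) (P.sym (setCol-off A k colₚ r p (λ p≡k → k≢p (P.sym p≡k)))))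
    B≈A+γA′ : ∀ r → B r k ≈ 1# * A r k + γ * A′ r k
    B≈A+γA′ r = trans (added r) (+-cong (sym (*-identityˡ _)) (*-congˡ (reflexive (P.sym (setCol-at A k colₚ r)))))

  -- Rectangular matrices and the column operation adding γ x times column p
  -- to each column x (the operation is meant for γ p = 0).
  Matrix : ℕ → ℕ → Set c
  Matrix rows cols = Fin rows → Fin cols → Carrier

  colOp : ∀ {rows cols} → Matrix rows cols → Fin cols → (Fin cols → Carrier) → Matrix rows cols
  colOp A p γ r x = A r x + γ x * A r p

  -- det (colOp A p γ) = det A when γ p = 0, proved by clearing the coefficients
  -- one column at a time: induction on a bound mm with γ x = 0 for toℕ x ≥ mm.
  det-colOp-below : ∀ n (A : Mat n) p mm (γ : Fin n → Carrier) → γ p ≈ 0# →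
    (∀ x → mm ℕ.≤ toℕ x → γ x ≈ 0#) → det n (colOp A p γ) ≈ det n A
  det-colOp-below n A p zero γ γp≈0 γ≈0 =
    det-cong n (λ r x → trans (+-congˡ (*-congʳ (γ≈0 x ℕ.z≤n))) (x+0y≈x _ _))
  det-colOp-below n A p (suc mm) γ γp≈0 γ≈0 with mm ℕ.<? n
  ... | no mm≮n = det-colOp-below n A p mm γ γp≈0 (λ x mm≤x → ⊥-elim (mm≮n (ℕP.≤-<-trans mm≤x (FinP.toℕ<n x))))
  ... | yes mm<n = trans clearOne (det-colOp-below n A p mm γ′ γ′p≈0 γ′≈0)
    where
    k : Fin n
    k = fromℕ< mm<n
    γ′ : Fin n → Carrier
    γ′ = updateAt γ k (λ _ → 0#)
    γ′-off : ∀ x → x ≢ k → γ′ x ≈ γ x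
    γ′-off x x≢k = reflexive (updateAt-minimal x k γ x≢k)
    γ′p≈0 : γ′ p ≈ 0#
    γ′p≈0 with p Fin.≟ k
    ... | yes P.refl = reflexive (updateAt-updates p γ)
    ... | no p≢k = trans (γ′-off p p≢k) γp≈0
    γ′≈0 : ∀ x → mm ℕ.≤ toℕ x → γ′ x ≈ 0#
    γ′≈0 x mm≤x with x Fin.≟ k
    ... | yes P.refl = reflexive (updateAt-updates x γ)
    ... | no x≢k = trans (γ′-off x x≢k) (γ≈0 x (ℕP.≤∧≢⇒< mm≤x (λ mm≡x → x≢k (FinP.toℕ-injective
                     (P.trans (P.sym mm≡x) (P.sym (FinP.toℕ-fromℕ< mm<n)))))))
    -- colOp A p γ arises from colOp A p γ′ by adding γ k times column p to column k
    clearOne : det n (colOp A p γ) ≈ det n (colOp A p γ′)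
    clearOne with k Fin.≟ p
    ... | yes P.refl = det-cong n λ r x → +-congˡ (*-congʳ (γ≈γ′ x))
      where
      γ≈γ′ : ∀ x → γ x ≈ γ′ x
      γ≈γ′ x with x Fin.≟ k
      ... | yes P.refl = trans γp≈0 (sym γ′p≈0)
      ... | no x≢k = sym (γ′-off x x≢k)
    ... | no k≢p = det-addCol n (colOp A p γ′) (colOp A p γ) p k (γ k) k≢p
      (λ r x x≢k → +-congˡ (*-congʳ (γ′-off x x≢k)))
      (λ r → begin
        A r k + γ k * A r p                               ≈⟨ +-congʳ (x+0y≈x _ _) ⟨
        (A r k + 0# * A r p) + γ k * A r p                ≈⟨ +-cong (+-congˡ (*-congʳ (reflexive (updateAt-updates k γ))))
                                                                   (*-congˡ (x+0y≈x _ _)) ⟨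
        colOp A p γ′ r k + γ k * (A r p + 0# * A r p)      ≈⟨ +-congˡ (*-congˡ (+-congˡ (*-congʳ γ′p≈0))) ⟨
        colOp A p γ′ r k + γ k * colOp A p γ′ r p          ∎)

  det-colOp : ∀ n (A : Mat n) p (γ : Fin n → Carrier) → γ p ≈ 0# → det n (colOp A p γ) ≈ det n A
  det-colOp n A p γ γp≈0 = det-colOp-below n A p n γ γp≈0 (λ x n≤x → ⊥-elim (ℕP.<⇒≱ (FinP.toℕ<n x) n≤x))

  -- Elimination against a pivot p of the first row, given β with A 0 p · β = 1:
  -- the coefficients clearing the first row outside column p, and the matrix
  -- left after clearing and deleting row 0 and column p.
  pivotCoeffs : ∀ {rows cols} → Matrix (suc rows) (suc cols) → Fin (suc cols) → Carrier → Fin (suc cols) → Carrier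
  pivotCoeffs A p β = insertAt (λ s → - (A zero (punchIn p s) * β)) p 0#

  eliminate : ∀ {rows cols} → Matrix (suc rows) (suc cols) → Fin (suc cols) → Carrier → Matrix rows cols
  eliminate A p β r s = colOp A p (pivotCoeffs A p β) (suc r) (punchIn p s)

  cleared-entry : ∀ {rows cols} (A : Matrix (suc rows) (suc cols)) p β r s →
    colOp A p (pivotCoeffs A p β) r (punchIn p s) ≈ A r (punchIn p s) + (- (A zero (punchIn p s) * β)) * A r p
  cleared-entry A p β r s = +-congˡ (*-congʳ (reflexive (insertAt-punchIn _ p 0# s)))

  -- After clearing, only the pivot term of the Laplace expansion survives.
  det-pivot : ∀ n (A : Mat (suc n)) p β → A zero p * β ≈ 1# →
    det (suc n) A ≈ (sgn (toℕ p) * A zero p) * det n (eliminate A p β)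
  det-pivot n A p β pivot = begin
    det (suc n) A                                   ≈⟨ det-colOp (suc n) A p γ (reflexive (insertAt-lookup _ p 0#)) ⟨
    det (suc n) C                                   ≈⟨ sumF-punch n (term C) p ⟩
    term C p + sumF n (λ s → term C (punchIn p s))  ≈⟨ +-congˡ (sumF-zero n offPivot) ⟩
    term C p + 0#                                   ≈⟨ +-identityʳ _ ⟩
    (sgn (toℕ p) * (A zero p + γ p * A zero p)) * det n (eliminate A p β)
                                  ≈⟨ *-congʳ (*-congˡ (trans (+-congˡ (*-congʳ (reflexive (insertAt-lookup _ p 0#))))
                                                             (x+0y≈x _ _))) ⟩
    (sgn (toℕ p) * A zero p) * det n (eliminate A p β) ∎
    where
    γ : Fin (suc n) → Carrier
    γ = pivotCoeffs A p β
    C : Mat (suc n)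
    C = colOp A p γ
    offPivot : ∀ s → term C (punchIn p s) ≈ 0#
    offPivot s = trans (*-congʳ (trans (*-congˡ (trans (cleared-entry A p β zero s) (cleared _ _ β pivot))) (zeroʳ _)))
                       (zeroˡ _)

  _·ᵥ_ : ∀ {rows cols} → Matrix rows cols → (Fin cols → Carrier) → Fin rows → Carrier
  _·ᵥ_ {cols = cols} A a r = sumF cols (λ j → A r j * a j)

  TrivialKernel : ∀ {rows cols} → Matrix rows cols → Set (c ⊔ ℓ)
  TrivialKernel A = ∀ a → (∀ r → (A ·ᵥ a) r ≈ 0#) → ∀ j → a j ≈ 0#

  -- Cramer's rule in the form  A a = 0 ⇒ a k · det A = 0: replacing column k
  -- of A by the zero column A a = Σ_l a_l (column l) expands into
  -- Σ_l a_l det(A with column k := column l), where only l = k survives.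
  cramer : ∀ n (A : Mat n) (a : Fin n → Carrier) → (∀ r → (A ·ᵥ a) r ≈ 0#) → ∀ k → a k * det n A ≈ 0#
  cramer n A a Aa≈0 k = begin
    a k * det n A                                    ≈⟨ *-congˡ (det-cong n unchanged) ⟨
    a k * det n (setCol A k (col k))                 ≈⟨ sumF-single n (λ l → a l * det n (setCol A k (col l))) k repeated ⟨
    sumF n (λ l → a l * det n (setCol A k (col l)))  ≈⟨ det-setCol-sum n A k n a col ⟨
    det n (setCol A k (λ r → sumF n (λ l → a l * A r l)))
      ≈⟨ det-zeroCol n _ k (λ r → trans (reflexive (setCol-at A k (λ r → sumF n (λ l → a l * A r l)) r))
                                  (trans (sumF-cong n (λ l → *-comm (a l) (A r l))) (Aa≈0 r))) ⟩
    0#                                               ∎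
    where
    col : Fin n → Fin n → Carrier
    col l r = A r l
    unchanged : ∀ r j → setCol A k (col k) r j ≈ A r j
    unchanged r j with j Fin.≟ k
    ... | yes P.refl = reflexive (setCol-at A k (col k) r)
    ... | no j≢k = reflexive (setCol-off A k (col k) r j j≢k)
    repeated : ∀ l → l ≢ k → a l * det n (setCol A k (col l)) ≈ 0#
    repeated l l≢k = trans (*-congˡ (det-equalCols n _ l k l≢k (λ r →
      reflexive (P.trans (setCol-off A k (col l) r l l≢k) (P.sym (setCol-at A k (col l) r)))))) (zeroʳ _)

  det≉0⇒trivialKernel : ∀ n (A : Mat n) → ¬ (det n A ≈ 0#) → TrivialKernel A
  det≉0⇒trivialKernel n A det≉0 a Aa≈0 j = cancel (det n A) (a j) det≉0 (trans (*-comm _ _) (cramer n A a Aa≈0 j))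

  -- Elimination preserves a trivial kernel: a kernel vector c of the
  -- eliminated matrix lifts to the kernel vector of A that is c off column p
  -- and Σ_s γ_s c_s at p (γ the clearing coefficients), so c vanishes.
  eliminate-trivialKernel : ∀ {rows cols} (A : Matrix (suc rows) (suc cols)) p β → A zero p * β ≈ 1# →
    TrivialKernel A → TrivialKernel (eliminate A p β)
  eliminate-trivialKernel {rows} {cols} A p β pivot trivial c Ec≈0 s = begin
    c s                 ≡⟨ insertAt-punchIn c p σ s ⟨
    lift (punchIn p s)  ≈⟨ trivial lift lifted (punchIn p s) ⟩
    0#                  ∎
    where
    γ : Fin cols → Carrier
    γ s = - (A zero (punchIn p s) * β)
    σ : Carrier
    σ = sumF cols (λ s → γ s * c s)
    lift : Fin (suc cols) → Carrier
    lift = insertAt c p σ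
    split : ∀ r → (A ·ᵥ lift) r ≈ sumF cols (λ s → A r p * (γ s * c s) + A r (punchIn p s) * c s)
    split r = begin
      (A ·ᵥ lift) r
        ≈⟨ sumF-punch cols (λ x → A r x * lift x) p ⟩
      A r p * lift p + sumF cols (λ s → A r (punchIn p s) * lift (punchIn p s))
        ≈⟨ +-cong (*-congˡ (reflexive (insertAt-lookup c p σ)))
                  (sumF-cong cols (λ s → *-congˡ (reflexive (insertAt-punchIn c p σ s)))) ⟩
      A r p * σ + sumF cols (λ s → A r (punchIn p s) * c s)
        ≈⟨ +-congʳ (sumF-* cols (A r p) (λ s → γ s * c s)) ⟨
      sumF cols (λ s → A r p * (γ s * c s)) + sumF cols (λ s → A r (punchIn p s) * c s)
        ≈⟨ sumF-+ cols (λ s → A r p * (γ s * c s)) (λ s → A r (punchIn p s) * c s) ⟨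
      sumF cols (λ s → A r p * (γ s * c s) + A r (punchIn p s) * c s) ∎
    factor : ∀ r s → A r p * (γ s * c s) + A r (punchIn p s) * c s ≈ colOp A p (pivotCoeffs A p β) r (punchIn p s) * c s
    factor r s = trans (solve 4 (λ a g b x → a :* (g :* x) :+ b :* x := (b :+ g :* a) :* x) refl (A r p) (γ s) _ (c s))
                       (*-congʳ (sym (cleared-entry A p β r s)))
    lifted : ∀ r → (A ·ᵥ lift) r ≈ 0#
    lifted zero = trans (split zero) (sumF-zero cols λ s →
      trans (factor zero s) (trans (*-congʳ (trans (cleared-entry A p β zero s) (cleared _ _ β pivot))) (zeroˡ _)))
    lifted (suc r) = trans (split (suc r)) (trans (sumF-cong cols (factor (suc r))) (Ec≈0 r))

  dropZeroRow-trivialKernel : ∀ {rows cols} (A : Matrix (suc rows) cols) → (∀ j → A zero j ≈ 0#) →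
    TrivialKernel A → TrivialKernel (λ r j → A (suc r) j)
  dropZeroRow-trivialKernel {cols = cols} A row₀≈0 trivial a A′a≈0 = trivial a λ
    { zero → sumF-zero cols (λ j → trans (*-congʳ (row₀≈0 j)) (zeroˡ _))
    ; (suc r) → A′a≈0 r }

  -- Deleting a column keeps the kernel trivial (pad kernel vectors with a 0).
  dropCol-trivialKernel : ∀ {rows cols} (A : Matrix rows (suc cols)) →
    TrivialKernel A → TrivialKernel (λ r j → A r (suc j))
  dropCol-trivialKernel A trivial a A′a≈0 j =
    trivial (insertAt a zero 0#) (λ r → trans (+-congʳ (zeroʳ _)) (trans (+-identityˡ _) (A′a≈0 r))) (suc j)

  wide-nontrivialKernel : ∀ n (A : Matrix n (suc n)) → ¬ TrivialKernel A
  wide-nontrivialKernel zero A trivial = 0≉1 (sym (trivial (λ _ → 1#) (λ ()) zero))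
  wide-nontrivialKernel (suc n) A trivial = zero-or-nonzero (suc (suc n)) (A zero) [ zeroRow , pivotRow ]
    where
    zeroRow : (∀ j → A zero j ≈ 0#) → ⊥
    zeroRow row₀≈0 = wide-nontrivialKernel n (λ r j → A (suc r) (suc j))
      (dropCol-trivialKernel (λ r j → A (suc r) j) (dropZeroRow-trivialKernel A row₀≈0 trivial))
    pivotRow : (∃ λ p → ¬ (A zero p ≈ 0#)) → ⊥
    pivotRow (p , Ap≉0) with inverse (A zero p) Ap≉0
    ... | β , pivot = wide-nontrivialKernel n (eliminate A p β) (eliminate-trivialKernel A p β pivot trivial)

  -- A square matrix with trivial kernel has nonzero determinant: a zero first
  -- row is excluded by the previous lemma, and otherwise det A is a nonzero
  -- multiple of det of the eliminated matrix, which has trivial kernel.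
  trivialKernel⇒det≉0 : ∀ n (A : Mat n) → TrivialKernel A → ¬ (det n A ≈ 0#)
  trivialKernel⇒det≉0 zero A trivial det≈0 = 0≉1 (sym det≈0)
  trivialKernel⇒det≉0 (suc n) A trivial det≈0 = zero-or-nonzero (suc n) (A zero) [ zeroRow , pivotRow ]
    where
    zeroRow : (∀ j → A zero j ≈ 0#) → ⊥
    zeroRow row₀≈0 = wide-nontrivialKernel n (λ r j → A (suc r) j) (dropZeroRow-trivialKernel A row₀≈0 trivial)
    pivotRow : (∃ λ p → ¬ (A zero p ≈ 0#)) → ⊥
    pivotRow (p , Ap≉0) with inverse (A zero p) Ap≉0
    ... | β , pivot = trivialKernel⇒det≉0 n (eliminate A p β) (eliminate-trivialKernel A p β pivot trivial)
        (cancel (sgn (toℕ p) * A zero p) _ sA≉0 (trans (sym (det-pivot n A p β pivot)) det≈0))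
      where
      sA≉0 : ¬ (sgn (toℕ p) * A zero p ≈ 0#)
      sA≉0 sA≈0 = Ap≉0 (cancel (sgn (toℕ p)) (A zero p) (sgn≉0 (toℕ p)) sA≈0)

  trivialKernel⇔det≉0 : ∀ n (A : Mat n) → TrivialKernel A ⇔ (¬ (det n A ≈ 0#))
  trivialKernel⇔det≉0 n A = mk⇔ (trivialKernel⇒det≉0 n A) (det≉0⇒trivialKernel n A)

  -- A square matrix with a left inverse B has trivial kernel: b = (B T) b = B (T b).
  leftInverse⇒trivialKernel : ∀ n (T B : Mat n) → (B · T) ≈M I → TrivialKernel T
  leftInverse⇒trivialKernel n T B BT≈I b Tb≈0 j = begin
    b j                                             ≈⟨ *-identityˡ _ ⟨
    1# * b j                                        ≈⟨ *-congʳ (reflexive I-diag) ⟨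
    I j j * b j                                     ≈⟨ sumF-single n (λ k → I j k * b k) j I-off ⟨
    sumF n (λ k → I j k * b k)                      ≈⟨ sumF-cong n (λ k → *-congʳ (BT≈I j k)) ⟨
    sumF n (λ k → sumF n (λ r → B j r * T r k) * b k)
      ≈⟨ sumF-cong n (λ k → trans (*-comm _ _) (trans (sym (sumF-* n (b k) (λ r → B j r * T r k)))
           (sumF-cong n (λ r → solve 3 (λ x y z → z :* (x :* y) := x :* (y :* z)) refl (B j r) (T r k) (b k))))) ⟩
    sumF n (λ k → sumF n (λ r → B j r * (T r k * b k))) ≈⟨ sumF-swap n n (λ k r → B j r * (T r k * b k)) ⟩
    sumF n (λ r → sumF n (λ k → B j r * (T r k * b k))) ≈⟨ sumF-cong n (λ r → sumF-* n (B j r) (λ k → T r k * b k)) ⟩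
    sumF n (λ r → B j r * (T ·ᵥ b) r)                 ≈⟨ sumF-zero n (λ r → trans (*-congˡ (Tb≈0 r)) (zeroʳ _)) ⟩
    0#                                              ∎
    where
    I-diag : I j j ≡ 1#
    I-diag with j Fin.≟ j
    ... | yes _ = P.refl
    ... | no j≢j = ⊥-elim (j≢j P.refl)
    I-off : ∀ k → k ≢ j → I j k * b k ≈ 0#
    I-off k k≢j with j Fin.≟ k
    ... | yes j≡k = ⊥-elim (k≢j (P.sym j≡k))
    ... | no _ = zeroˡ (b k)

  open Module M using (Carrierᴹ; _≈ᴹ_; _+ᴹ_; _*ₗ_; 0ᴹ; *ₗ-zeroˡ; *ₗ-zeroʳ; *ₗ-distribˡ; *ₗ-distribʳ; *ₗ-assoc;
                       *ₗ-cong; +ᴹ-cong; +ᴹ-identityˡ; ≈ᴹ-refl; ≈ᴹ-sym; ≈ᴹ-trans; ≈ᴹ-setoid;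
                       +ᴹ-commutativeMonoid)
  open import Algebra.Properties.CommutativeSemigroup (CommutativeMonoid.commutativeSemigroup +ᴹ-commutativeMonoid)
    using (interchange)
  module ᴹ = Relation.Binary.Reasoning.Setoid ≈ᴹ-setoid

  lc-cong : ∀ {n} {a b : Fin n → Carrier} (w : Fin n → Carrierᴹ) → (∀ k → a k ≈ b k) → lc a w ≈ᴹ lc b w
  lc-cong {zero} w a≈b = ≈ᴹ-refl
  lc-cong {suc n} w a≈b = +ᴹ-cong (*ₗ-cong (a≈b zero) ≈ᴹ-refl) (lc-cong (λ k → w (suc k)) (λ k → a≈b (suc k)))

  lc-zero : ∀ {n} {a : Fin n → Carrier} (w : Fin n → Carrierᴹ) → (∀ k → a k ≈ 0#) → lc a w ≈ᴹ 0ᴹ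
  lc-zero {zero} w a≈0 = ≈ᴹ-refl
  lc-zero {suc n} w a≈0 = ≈ᴹ-trans (+ᴹ-cong (≈ᴹ-trans (*ₗ-cong (a≈0 zero) ≈ᴹ-refl) (*ₗ-zeroˡ _))
                                             (lc-zero (λ k → w (suc k)) (λ k → a≈0 (suc k))))
                                   (+ᴹ-identityˡ 0ᴹ)

  lc-+ : ∀ {n} (a b : Fin n → Carrier) (w : Fin n → Carrierᴹ) → lc (λ k → a k + b k) w ≈ᴹ lc a w +ᴹ lc b w
  lc-+ {zero} a b w = ≈ᴹ-sym (+ᴹ-identityˡ 0ᴹ)
  lc-+ {suc n} a b w = ≈ᴹ-trans
    (+ᴹ-cong (*ₗ-distribʳ (w zero) (a zero) (b zero)) (lc-+ (λ k → a (suc k)) (λ k → b (suc k)) (λ k → w (suc k))))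
    (interchange _ _ _ _)

  lc-* : ∀ {n} x (a : Fin n → Carrier) (w : Fin n → Carrierᴹ) → lc (λ k → x * a k) w ≈ᴹ x *ₗ lc a w
  lc-* {zero} x a w = ≈ᴹ-sym (*ₗ-zeroʳ x)
  lc-* {suc n} x a w = ≈ᴹ-trans
    (+ᴹ-cong (*ₗ-assoc x (a zero) (w zero)) (lc-* x (λ k → a (suc k)) (λ k → w (suc k))))
    (≈ᴹ-sym (*ₗ-distribˡ x _ _))

  lc-lc : ∀ rows cols (C : Matrix rows cols) (b : Fin cols → Carrier) (u : Fin rows → Carrierᴹ) →
    lc b (λ j → lc (λ r → C r j) u) ≈ᴹ lc (C ·ᵥ b) u
  lc-lc rows zero C b u = ≈ᴹ-sym (lc-zero u (λ _ → refl))
  lc-lc rows (suc cols) C b u = ᴹ.begin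
    b zero *ₗ lc (λ r → C r zero) u +ᴹ lc (λ k → b (suc k)) (λ j → lc (λ r → C r (suc j)) u)
      ᴹ.≈⟨ +ᴹ-cong (≈ᴹ-sym (lc-* (b zero) (λ r → C r zero) u)) (lc-lc rows cols (λ r j → C r (suc j)) (λ k → b (suc k)) u) ⟩
    lc (λ r → b zero * C r zero) u +ᴹ lc (λ r → sumF cols (λ j → C r (suc j) * b (suc j))) u
      ᴹ.≈⟨ lc-+ _ _ u ⟨
    lc (λ r → b zero * C r zero + sumF cols (λ j → C r (suc j) * b (suc j))) u
      ᴹ.≈⟨ lc-cong u (λ r → +-congʳ (*-comm _ _)) ⟩
    lc (C ·ᵥ b) u ᴹ.∎

  coordinates-unique : ∀ {n} (u : Fin n → Carrierᴹ) → IsBasis u → ∀ a b → lc a u ≈ᴹ lc b u → ∀ k → a k ≈ b k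
  coordinates-unique u (_ , independent) a b a≈b k = x∙y⁻¹≈ε⇒x≈y (a k) (b k) (independent (λ k → a k + - b k) diff≈0 k)
    where
    diff≈0 : lc (λ k → a k + - b k) u ≈ᴹ 0ᴹ
    diff≈0 = ᴹ.begin
      lc (λ k → a k + - b k) u        ᴹ.≈⟨ lc-+ a (λ k → - b k) u ⟩
      lc a u +ᴹ lc (λ k → - b k) u    ᴹ.≈⟨ +ᴹ-cong a≈b ≈ᴹ-refl ⟩
      lc b u +ᴹ lc (λ k → - b k) u    ᴹ.≈⟨ lc-+ b (λ k → - b k) u ⟨
      lc (λ k → b k + - b k) u        ᴹ.≈⟨ lc-zero u (λ k → -‿inverseʳ (b k)) ⟩
      0ᴹ                              ᴹ.∎

  -- Let u be a basis, v = T u with T of trivial kernel, and S the block of T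
  -- formed by rows φ r (the first h rows) and columns ψ l (the columns from s
  -- on).  A vector Σ_{j ≥ s} b_j v_j has u-coordinates T b, whose first h
  -- entries are S applied to (b_j)_{j ≥ s}.
  module TailBlock {n h s len : ℕ} (T : Mat n) (u : Fin n → Carrierᴹ) (basis : IsBasis u)
    (T-trivial : TrivialKernel T) (S : Matrix h len)
    (φ : Fin h → Fin n) (φ-toℕ : ∀ r → toℕ (φ r) ≡ toℕ r)
    (ψ : Fin len → Fin n) (ψ-toℕ : ∀ l → toℕ (ψ l) ≡ s ℕ.+ toℕ l) (s+len≡n : s ℕ.+ len ≡ n)
    (S≡T : ∀ r l → S r l ≡ T (φ r) (ψ l)) where

    v : Fin n → Carrierᴹ
    v = transformed T u

    lc-v : ∀ b → lc b v ≈ᴹ lc (T ·ᵥ b) u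
    lc-v b = lc-lc n n T b u

    block-rows : ∀ b → VanishBelow s b → ∀ r → (T ·ᵥ b) (φ r) ≈ (S ·ᵥ (λ l → b (ψ l))) r
    block-rows b b≈0 r = trans
      (sumF-tail s n len (λ j → T (φ r) j * b j) ψ ψ-toℕ s+len≡n (λ j j<s → trans (*-congˡ (b≈0 j j<s)) (zeroʳ _)))
      (sumF-cong len (λ l → *-congʳ (reflexive (P.sym (S≡T r l)))))

    row-index : ∀ r → toℕ r ℕ.< h → Σ (Fin h) λ r′ → φ r′ ≡ r
    row-index r r<h = fromℕ< r<h , FinP.toℕ-injective (P.trans (φ-toℕ _) (FinP.toℕ-fromℕ< r<h))

    col-index : ∀ j → s ℕ.≤ toℕ j → Σ (Fin len) λ l → ψ l ≡ j
    col-index j s≤j = fromℕ< j∸s<len , FinP.toℕ-injective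
      (P.trans (ψ-toℕ _) (P.trans (P.cong (s ℕ.+_) (FinP.toℕ-fromℕ< j∸s<len)) (ℕP.m+[n∸m]≡n s≤j)))
      where
      j∸s<len : toℕ j ∸ s ℕ.< len
      j∸s<len = P.subst (toℕ j ∸ s ℕ.<_) (ℕP.m+n∸m≡n s len)
                  (ℕP.∸-monoˡ-< (P.subst (toℕ j ℕ.<_) (P.sym s+len≡n) (FinP.toℕ<n j)) s≤j)

    ψ-injective : ∀ l l′ → ψ l ≡ ψ l′ → l ≡ l′
    ψ-injective l l′ ψl≡ψl′ = FinP.toℕ-injective (ℕP.+-cancelˡ-≡ s _ _
      (P.trans (P.sym (ψ-toℕ l)) (P.trans (P.cong toℕ ψl≡ψl′) (ψ-toℕ l′))))

    tail-zero : ∀ b → VanishBelow s b → (∀ l → b (ψ l) ≈ 0#) → ∀ j → b j ≈ 0#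
    tail-zero b b≈0 bψ≈0 j with toℕ j ℕ.<? s
    ... | yes j<s = b≈0 j j<s
    ... | no j≮s with col-index j (ℕP.≮⇒≥ j≮s)
    ...   | l , P.refl = bψ≈0 l

    pad : (Fin len → Carrier) → Fin n → Carrier
    pad c j with toℕ j ℕ.<? s
    ... | yes _ = 0#
    ... | no j≮s = c (proj₁ (col-index j (ℕP.≮⇒≥ j≮s)))

    pad-below : ∀ c → VanishBelow s (pad c)
    pad-below c j j<s with toℕ j ℕ.<? s
    ... | yes _ = refl
    ... | no j≮s = ⊥-elim (j≮s j<s)

    pad-ψ : ∀ c l → pad c (ψ l) ≈ c l
    pad-ψ c l with toℕ (ψ l) ℕ.<? s
    ... | yes ψl<s = ⊥-elim (ℕP.<⇒≱ ψl<s (P.subst (s ℕ.≤_) (P.sym (ψ-toℕ l)) (ℕP.m≤m+n s (toℕ l))))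
    ... | no ψl≮s = reflexive (P.cong c (ψ-injective _ l (proj₂ (col-index (ψ l) (ℕP.≮⇒≥ ψl≮s)))))

    kernel⇒meet : TrivialKernel S → ∀ x → (∃ λ a → VanishBelow h a × x ≈ᴹ lc a u) →
                  (∃ λ b → VanishBelow s b × x ≈ᴹ lc b v) → x ≈ᴹ 0ᴹ
    kernel⇒meet S-trivial x (a , a≈0 , x≈au) (b , b≈0 , x≈bv) =
      ≈ᴹ-trans x≈bv (lc-zero v (tail-zero b b≈0 (S-trivial _ Sb≈0)))
      where
      a≈Tb : ∀ r → a r ≈ (T ·ᵥ b) r
      a≈Tb = coordinates-unique u basis a (T ·ᵥ b) (≈ᴹ-trans (≈ᴹ-sym x≈au) (≈ᴹ-trans x≈bv (lc-v b)))
      Sb≈0 : ∀ r → (S ·ᵥ (λ l → b (ψ l))) r ≈ 0#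
      Sb≈0 r = begin
        (S ·ᵥ (λ l → b (ψ l))) r   ≈⟨ block-rows b b≈0 r ⟨
        (T ·ᵥ b) (φ r)             ≈⟨ a≈Tb (φ r) ⟨
        a (φ r)                    ≈⟨ a≈0 (φ r) (P.subst (ℕ._< h) (P.sym (φ-toℕ r)) (FinP.toℕ<n r)) ⟩
        0#                         ∎

    meet⇒kernel : (∀ x → (∃ λ a → VanishBelow h a × x ≈ᴹ lc a u) →
                         (∃ λ b → VanishBelow s b × x ≈ᴹ lc b v) → x ≈ᴹ 0ᴹ) → TrivialKernel S
    meet⇒kernel meet c Sc≈0 l = trans (sym (pad-ψ c l)) (pad≈0 (ψ l))
      where
      Tpad-below : VanishBelow h (T ·ᵥ pad c)
      Tpad-below r r<h with row-index r r<h
      ... | r′ , P.refl = trans (block-rows (pad c) (pad-below c) r′)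
                                (trans (sumF-cong len (λ l → *-congˡ (pad-ψ c l))) (Sc≈0 r′))
      x≈0 : lc (pad c) v ≈ᴹ 0ᴹ
      x≈0 = meet _ (T ·ᵥ pad c , Tpad-below , lc-v (pad c)) (pad c , pad-below c , ≈ᴹ-refl)
      pad≈0 : ∀ j → pad c j ≈ 0#
      pad≈0 = T-trivial (pad c) (proj₂ basis (T ·ᵥ pad c) (≈ᴹ-trans (≈ᴹ-sym (lc-v (pad c))) x≈0))

    tailSpans⇔blockKernel : ∀ i j → (n ∸ 1) ∸ i ≡ h → (n ∸ 1) ∸ j ≡ s →
      TrivialIntersection (InTailSpan u i) (InTailSpan v j) ⇔ TrivialKernel S
    tailSpans⇔blockKernel i j e₁ e₂ = mk⇔
      (λ meet → meet⇒kernel λ x (a , a≈0 , x≈au) (b , b≈0 , x≈bv) →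
        meet x (a , VanishBelow-cong (P.sym e₁) a≈0 , x≈au) (b , VanishBelow-cong (P.sym e₂) b≈0 , x≈bv))
      (λ S-trivial x (a , a≈0 , x≈au) (b , b≈0 , x≈bv) →
        kernel⇒meet S-trivial x (a , VanishBelow-cong e₁ a≈0 , x≈au) (b , VanishBelow-cong e₂ b≈0 , x≈bv))

  entry-toℕ : ∀ {n} (T : Mat n) (x y : Fin n) → entry T (toℕ x) (toℕ y) ≡ T x y
  entry-toℕ {n} T x y with toℕ x ℕ.<? n | toℕ y ℕ.<? n
  ... | yes x< | yes y< = P.cong₂ T (FinP.fromℕ<-toℕ x x<) (FinP.fromℕ<-toℕ y y<)
  ... | no x≮ | _ = ⊥-elim (x≮ (FinP.toℕ<n x))
  ... | yes _ | no y≮ = ⊥-elim (y≮ (FinP.toℕ<n y))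

  -- For t < d, T[t+1, d] is the block of a (d+1)×(d+1) matrix T formed by the
  -- first d - t rows and the columns from t + 1 on; the thresholds of the two
  -- tail spans in the theorem are exactly d - t and t + 1.
  module SubmatrixIndexing (d t : ℕ) (t<d : t ℕ.< d) where
    len : ℕ
    len = suc (d ∸ suc t)

    rowThreshold : d ∸ t ≡ len
    rowThreshold = ∸-suc d t t<d
      where
      ∸-suc : ∀ d t → t ℕ.< d → d ∸ t ≡ suc (d ∸ suc t)
      ∸-suc (suc d) zero _ = P.refl
      ∸-suc (suc d) (suc t) (ℕ.s≤s t<d) = ∸-suc d t t<d

    colThreshold : d ∸ (d ∸ 1 ∸ t) ≡ suc t
    colThreshold = P.trans (P.cong (d ∸_) (ℕP.∸-+-assoc d 1 t)) (ℕP.m∸[m∸n]≡n t<d)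

    sizes : suc t ℕ.+ len ≡ suc d
    sizes = P.trans (ℕP.+-suc (suc t) (d ∸ suc t)) (P.cong suc (ℕP.m+[n∸m]≡n t<d))

    φ : Fin len → Fin (suc d)
    φ r = fromℕ< (ℕP.<-≤-trans (FinP.toℕ<n r) (ℕ.s≤s (ℕP.m∸n≤m d (suc t))))

    φ-toℕ : ∀ r → toℕ (φ r) ≡ toℕ r
    φ-toℕ r = FinP.toℕ-fromℕ< _

    ψ-bound : ∀ (l : Fin len) → suc t ℕ.+ toℕ l ℕ.< suc d
    ψ-bound l = P.subst (suc t ℕ.+ toℕ l ℕ.<_) sizes (ℕP.+-monoʳ-< (suc t) (FinP.toℕ<n l))

    ψ : Fin len → Fin (suc d)
    ψ l = fromℕ< (ψ-bound l)

    ψ-toℕ : ∀ l → toℕ (ψ l) ≡ suc t ℕ.+ toℕ l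
    ψ-toℕ l = FinP.toℕ-fromℕ< (ψ-bound l)

    sub≡block : ∀ (T : Mat (suc d)) r l → sub T (suc t) d r l ≡ T (φ r) (ψ l)
    sub≡block T r l = P.trans (P.cong₂ (entry T) (P.sym (φ-toℕ r)) (P.sym (ψ-toℕ l))) (entry-toℕ T (φ r) (ψ l))

lemma4p9 : ∀ {c ℓ m ℓm} (F : Field c ℓ) (M : Module (Field.commutativeRing F) m ℓm)
           → let open Setup F M in
             (d : ℕ) (T : Mat (suc d)) → Invertible T → UpperTriangular T
           → (u : Fin (suc d) → Module.Carrierᴹ M) → IsBasis u
           → (i : Fin d)
           → TrivialIntersection (InTailSpan u (toℕ i))
                                 (InTailSpan (transformed T u) (d ∸ 1 ∸ toℕ i))
             ⇔ (¬ (Field._≈_ F (det (suc (d ∸ suc (toℕ i))) (sub T (suc (toℕ i)) d)) (Field.0# F)))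
lemma4p9 F M d T (B , _ , BT≈I) _ u basis i =
  ⇔-trans (tailSpans⇔blockKernel (toℕ i) (d ∸ 1 ∸ toℕ i) rowThreshold colThreshold)
          (trivialKernel⇔det≉0 len S)
  where
  open Setup F M using (Mat; sub)
  open LinearAlgebra F M
  open SubmatrixIndexing d (toℕ i) (FinP.toℕ<n i)
  S : Mat len
  S = sub T (suc (toℕ i)) d
  open TailBlock T u basis (leftInverse⇒trivialKernel (suc d) T B BT≈I) S φ φ-toℕ ψ ψ-toℕ sizes (sub≡block T)
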